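{- Let $G$ be a graph and $L=L(G)$ its line graph. Then $L$ is chordal if and only if every cycle in $G$ (not only chordless ones) is a triangle, i.e. has length $3$.
   Context: Graphs are finite, simple and undirected. The line graph $L(G)$ has vertex set $E(G)$, two edges adjacent iff they share an endvertex. A graph is chordal if it has no induced cycle of length at least $4$. A cycle in $G$ means a cycle subgraph of $G$. -}

module Defs where

open import Data.Nat as ℕ using (ℕ; zero; suc; _≤_; _%_)
open import Data.Nat.DivMod using (m%n<n)
open import Data.Fin as Fin using (Fin; toℕ; fromℕ<; _<_)
open import Data.Bool using (Bool; true; false)
open import Data.Product using (Σ; _×_; _,_; proj₁; proj₂)
open import Data.Sum using (_⊎_)
open import Relation.Binary.PropositionalEquality using (_≡_; _≢_; refl; trans) renaming (sym to ≡-sym)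
open import Data.Empty using (⊥)
open import Relation.Nullary using (¬_)

record Graph : Set₁ where
  field
    V     : Set
    _∼_   : V → V → Set
    sym   : ∀ {u v} → u ∼ v → v ∼ u
    irrefl : ∀ {v} → ¬ (v ∼ v)

record FinGraph (n : ℕ) : Set where
  field
    adj    : Fin n → Fin n → Bool
    sym    : ∀ u v → adj u v ≡ adj v u
    loopless : ∀ v → adj v v ≡ false

toGraph : ∀ {n} → FinGraph n → Graph
toGraph {n} G = record
  { V = Fin n
  ; _∼_ = λ u v → FinGraph.adj G u v ≡ true
  ; sym = λ {u} {v} p → trans (FinGraph.sym G v u) p
  ; irrefl = λ {v} p → absurd (trans (≡-sym (FinGraph.loopless G v)) p)
  }
  where
  absurd : false ≡ true → ⊥
  absurd ()

-- An edge {u,v} of G, represented uniquely by its endpoints with u < v.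
Edge : ∀ {n} → FinGraph n → Set
Edge {n} G = Σ (Fin n × Fin n) λ uv → (proj₁ uv < proj₂ uv) × (FinGraph.adj G (proj₁ uv) (proj₂ uv) ≡ true)

_∈ₑ_ : ∀ {n} {G : FinGraph n} → Fin n → Edge G → Set
w ∈ₑ ((u , v) , _) = (w ≡ u) ⊎ (w ≡ v)

LineGraph : ∀ {n} → FinGraph n → Graph
LineGraph {n} G = record
  { V = Edge G
  ; _∼_ = λ e f → (e ≢ f) × Σ (Fin n) (λ w → (_∈ₑ_ {G = G} w e) × (_∈ₑ_ {G = G} w f))
  ; sym = λ { (ne , w , a , b) → (λ eq → ne (≡-sym eq)) , w , b , a }
  ; irrefl = λ { (ne , _) → ne refl }
  }

next : ∀ {m} → Fin (suc m) → Fin (suc m)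
next {m} i = fromℕ< (m%n<n (suc (toℕ i)) (suc m))

IsCycle : (H : Graph) (m : ℕ) → (Fin (suc m) → Graph.V H) → Set
IsCycle H m c =
  (3 ≤ suc m) ×
  (∀ i j → c i ≡ c j → i ≡ j) ×
  (∀ i → Graph._∼_ H (c i) (c (next i)))

IsInducedCycle : (H : Graph) (m : ℕ) → (Fin (suc m) → Graph.V H) → Set
IsInducedCycle H m c =
  IsCycle H m c ×
  (∀ i j → i ≢ j → j ≢ next i → i ≢ next j → ¬ Graph._∼_ H (c i) (c j))

Chordal : Graph → Set
Chordal H = ∀ m (c : Fin (suc m) → Graph.V H) → 4 ≤ suc m → ¬ IsInducedCycle H m c

AllCyclesTriangles : Graph → Set
AllCyclesTriangles H = ∀ m (c : Fin (suc m) → Graph.V H) → IsCycle H m c → suc m ≡ 3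

-- The edges of a cycle of length k in G form an induced k-cycle of L(G), because two
-- edges of a cycle share an endvertex only when they are consecutive on it. Conversely,
-- in an induced k-cycle of L(G) with k ≥ 4, consecutive edges share a vertex, and these
-- shared vertices are pairwise distinct (a vertex lying on three edges of the cycle would
-- make two non-consecutive ones adjacent), so they form a k-cycle of G. Hence G has a
-- cycle of length at least 4 iff L(G) has an induced one.
module Submission where

open import Defs
open import Data.Nat as ℕ using (ℕ; zero; suc; _+_; _∸_; _%_; z<s; NonZero)
open import Data.Nat.Properties
  using (+-identityʳ; +-suc; +-comm; +-cancelˡ-≡; +-mono-<; <⇒≢; ≮⇒≥; m∸n+n≡m; m<n+o⇒m∸n<o; n≤1+n; ≤-trans; m≤n⇒m<n∨m≡n)
open import Data.Nat.DivMod using (m<n⇒m%n≡m; m≤n⇒[n∸m]%m≡n%m; [m+n]%n≡m%n; %-distribˡ-+; m%n%n≡m%n)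
open import Data.Nat.GeneralisedArithmetic using (fold; fold-+)
open import Data.Fin as Fin using (Fin; toℕ; _≟_)
open import Data.Fin.Properties using (toℕ-fromℕ<; toℕ-injective; toℕ<n; <-cmp)
open import Data.Product using (_×_; _,_; proj₁; proj₂)
open import Data.Sum using (_⊎_; inj₁; inj₂)
open import Data.Empty using (⊥; ⊥-elim)
open import Function using (_∘_)
open import Relation.Binary using (tri<; tri≈; tri>)
open import Relation.Binary.PropositionalEquality
open import Relation.Nullary using (¬_; yes; no)

[m+k]%n≢m : ∀ {m k n} .{{_ : NonZero n}} → m ℕ.< n → 0 ℕ.< k → k ℕ.< n → (m + k) % n ≢ m
[m+k]%n≢m {m} {k} {n} m<n 0<k k<n eq with m + k ℕ.<? n
... | yes m+k<n = <⇒≢ 0<k (sym (+-cancelˡ-≡ m k 0 (begin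
  m + k        ≡⟨ sym (m<n⇒m%n≡m m+k<n) ⟩
  (m + k) % n  ≡⟨ eq ⟩
  m            ≡⟨ sym (+-identityʳ m) ⟩
  m + 0        ∎)))
  where open ≡-Reasoning
... | no m+k≮n = <⇒≢ k<n (+-cancelˡ-≡ m k n (begin
  m + k          ≡⟨ sym (m∸n+n≡m n≤m+k) ⟩
  m + k ∸ n + n  ≡⟨ cong (_+ n) m+k∸n≡m ⟩
  m + n          ∎))
  where
  open ≡-Reasoning
  n≤m+k : n ℕ.≤ m + k
  n≤m+k = ≮⇒≥ m+k≮n
  m+k∸n≡m : m + k ∸ n ≡ m
  m+k∸n≡m = begin
    m + k ∸ n        ≡⟨ sym (m<n⇒m%n≡m (m<n+o⇒m∸n<o (m + k) n (+-mono-< m<n k<n))) ⟩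
    (m + k ∸ n) % n  ≡⟨ m≤n⇒[n∸m]%m≡n%m n≤m+k ⟩
    (m + k) % n      ≡⟨ eq ⟩
    m                ∎

module _ {m : ℕ} where

  toℕ-next-iterate : ∀ k (i : Fin (suc m)) → toℕ (fold i next k) ≡ (toℕ i + k) % suc m
  toℕ-next-iterate zero i = begin
    toℕ i                ≡⟨ sym (m<n⇒m%n≡m (toℕ<n i)) ⟩
    toℕ i % suc m        ≡⟨ cong (_% suc m) (sym (+-identityʳ (toℕ i))) ⟩
    (toℕ i + 0) % suc m  ∎
    where open ≡-Reasoning
  toℕ-next-iterate (suc k) i = begin
    toℕ (next (fold i next k))          ≡⟨ toℕ-fromℕ< _ ⟩
    suc (toℕ (fold i next k)) % suc m   ≡⟨ cong (λ x → suc x % suc m) (toℕ-next-iterate k i) ⟩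
    (1 + (toℕ i + k) % suc m) % suc m   ≡⟨ %-distribˡ-+ 1 ((toℕ i + k) % suc m) (suc m) ⟩
    (1 % suc m + (toℕ i + k) % suc m % suc m) % suc m
                                        ≡⟨ cong (λ x → (1 % suc m + x) % suc m) (m%n%n≡m%n (toℕ i + k) (suc m)) ⟩
    (1 % suc m + (toℕ i + k) % suc m) % suc m
                                        ≡⟨ sym (%-distribˡ-+ 1 (toℕ i + k) (suc m)) ⟩
    (1 + (toℕ i + k)) % suc m           ≡⟨ cong (_% suc m) (sym (+-suc (toℕ i) k)) ⟩
    (toℕ i + suc k) % suc m             ∎
    where open ≡-Reasoning

  next-iterate-≢ : ∀ k (i : Fin (suc m)) → 0 ℕ.< k → k ℕ.< suc m → fold i next k ≢ i
  next-iterate-≢ k i 0<k k<1+m eq =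
    [m+k]%n≢m (toℕ<n i) 0<k k<1+m (trans (sym (toℕ-next-iterate k i)) (cong toℕ eq))

  next-iterate-period : ∀ (i : Fin (suc m)) → fold i next (m + 1) ≡ i
  next-iterate-period i = toℕ-injective (begin
    toℕ (fold i next (m + 1))  ≡⟨ toℕ-next-iterate (m + 1) i ⟩
    (toℕ i + (m + 1)) % suc m  ≡⟨ cong (λ k → (toℕ i + k) % suc m) (+-comm m 1) ⟩
    (toℕ i + suc m) % suc m    ≡⟨ [m+n]%n≡m%n (toℕ i) (suc m) ⟩
    toℕ i % suc m              ≡⟨ m<n⇒m%n≡m (toℕ<n i) ⟩
    toℕ i                      ∎)
    where open ≡-Reasoning

  next-injective : ∀ {i j : Fin (suc m)} → next i ≡ next j → i ≡ j
  next-injective {i} {j} eq = begin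
    i                        ≡⟨ sym (next-iterate-period i) ⟩
    fold i next (m + 1)      ≡⟨ fold-+ i next m ⟩
    fold (next i) next m     ≡⟨ cong (λ x → fold x next m) eq ⟩
    fold (next j) next m     ≡⟨ sym (fold-+ j next m) ⟩
    fold j next (m + 1)      ≡⟨ next-iterate-period j ⟩
    j                        ∎
    where open ≡-Reasoning

module _ {n : ℕ} (G : FinGraph n) where
  open Graph (toGraph G) using (_∼_) renaming (sym to ∼-sym; irrefl to ∼-irrefl)
  open Graph (LineGraph G) using () renaming (_∼_ to _∼ᴸ_)

  _∈_ : Fin n → Edge G → Set
  w ∈ e = _∈ₑ_ {G = G} w e

  edge : ∀ {u v} → u ∼ v → Edge G
  edge {u} {v} u∼v with <-cmp u v
  ... | tri< u<v _ _   = (u , v) , u<v , u∼v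
  ... | tri≈ _ refl _  = ⊥-elim (∼-irrefl u∼v)
  ... | tri> _ _ v<u   = (v , u) , v<u , ∼-sym u∼v

  ∈-edgeˡ : ∀ {u v} (u∼v : u ∼ v) → u ∈ edge u∼v
  ∈-edgeˡ {u} {v} u∼v with <-cmp u v
  ... | tri< _ _ _     = inj₁ refl
  ... | tri≈ _ refl _  = ⊥-elim (∼-irrefl u∼v)
  ... | tri> _ _ _     = inj₂ refl

  ∈-edgeʳ : ∀ {u v} (u∼v : u ∼ v) → v ∈ edge u∼v
  ∈-edgeʳ {u} {v} u∼v with <-cmp u v
  ... | tri< _ _ _     = inj₂ refl
  ... | tri≈ _ refl _  = ⊥-elim (∼-irrefl u∼v)
  ... | tri> _ _ _     = inj₁ refl

  ∈-edge⁻ : ∀ {u v w} (u∼v : u ∼ v) → w ∈ edge u∼v → w ≡ u ⊎ w ≡ v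
  ∈-edge⁻ {u} {v} u∼v w∈e with <-cmp u v
  ∈-edge⁻ u∼v w∈e        | tri< _ _ _    = w∈e
  ∈-edge⁻ u∼v w∈e        | tri≈ _ refl _ = ⊥-elim (∼-irrefl u∼v)
  ∈-edge⁻ u∼v (inj₁ w≡v) | tri> _ _ _    = inj₂ w≡v
  ∈-edge⁻ u∼v (inj₂ w≡u) | tri> _ _ _    = inj₁ w≡u

  endpoints-adjacent : ∀ (e : Edge G) {a b} → a ∈ e → b ∈ e → a ≢ b → a ∼ b
  endpoints-adjacent _             (inj₁ refl) (inj₁ refl) a≢b = ⊥-elim (a≢b refl)
  endpoints-adjacent (_ , _ , u∼v) (inj₁ refl) (inj₂ refl) _   = u∼v
  endpoints-adjacent (_ , _ , u∼v) (inj₂ refl) (inj₁ refl) _   = ∼-sym u∼v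
  endpoints-adjacent _             (inj₂ refl) (inj₂ refl) a≢b = ⊥-elim (a≢b refl)

  module _ {m : ℕ} {c : Fin (suc m) → Fin n} (cycle : IsCycle (toGraph G) m c) where
    private
      c-injective : ∀ i j → c i ≡ c j → i ≡ j
      c-injective = proj₁ (proj₂ cycle)
      c-adjacent : ∀ i → c i ∼ c (next i)
      c-adjacent = proj₂ (proj₂ cycle)
      1<1+m : 1 ℕ.< suc m
      1<1+m = ≤-trans (n≤1+n 2) (proj₁ cycle)

    cycleEdge : Fin (suc m) → Edge G
    cycleEdge i = edge (c-adjacent i)

    ∈-cycleEdge⁻ : ∀ {w} i → w ∈ cycleEdge i → w ≡ c i ⊎ w ≡ c (next i)
    ∈-cycleEdge⁻ i = ∈-edge⁻ (c-adjacent i)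

    cycleEdge-injective : ∀ i j → cycleEdge i ≡ cycleEdge j → i ≡ j
    cycleEdge-injective i j eq
      with ∈-cycleEdge⁻ j (subst (c i ∈_) eq (∈-edgeˡ (c-adjacent i)))
         | ∈-cycleEdge⁻ j (subst (c (next i) ∈_) eq (∈-edgeʳ (c-adjacent i)))
    ... | inj₁ ci≡cj | _ = c-injective i j ci≡cj
    ... | inj₂ ci≡cj⁺ | inj₁ ci⁺≡cj =
      ⊥-elim (next-iterate-≢ 2 j z<s (proj₁ cycle)
        (trans (cong next (sym (c-injective _ _ ci≡cj⁺))) (c-injective _ _ ci⁺≡cj)))
    ... | inj₂ _ | inj₂ ci⁺≡cj⁺ = next-injective (c-injective _ _ ci⁺≡cj⁺)

    cycleEdges-induced : IsInducedCycle (LineGraph G) m cycleEdge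
    cycleEdges-induced = (proj₁ cycle , cycleEdge-injective , consecutive-adjacent) , chordless
      where
      consecutive-adjacent : ∀ i → cycleEdge i ∼ᴸ cycleEdge (next i)
      consecutive-adjacent i =
        (λ eq → next-iterate-≢ 1 i z<s 1<1+m (sym (cycleEdge-injective _ _ eq))) ,
        c (next i) , ∈-edgeʳ (c-adjacent i) , ∈-edgeˡ (c-adjacent (next i))
      chordless : ∀ i j → i ≢ j → j ≢ next i → i ≢ next j →
                  ¬ cycleEdge i ∼ᴸ cycleEdge j
      chordless i j i≢j j≢i⁺ i≢j⁺ (_ , w , w∈eᵢ , w∈eⱼ) with ∈-cycleEdge⁻ i w∈eᵢ | ∈-cycleEdge⁻ j w∈eⱼ
      ... | inj₁ refl | inj₁ ci≡cj  = i≢j (c-injective _ _ ci≡cj)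
      ... | inj₁ refl | inj₂ ci≡cj⁺ = i≢j⁺ (c-injective _ _ ci≡cj⁺)
      ... | inj₂ refl | inj₁ ci⁺≡cj = j≢i⁺ (sym (c-injective _ _ ci⁺≡cj))
      ... | inj₂ refl | inj₂ ci⁺≡cj⁺ = i≢j (next-injective (c-injective _ _ ci⁺≡cj⁺))

  module _ {m : ℕ} {e : Fin (suc m) → Edge G}
           (induced : IsInducedCycle (LineGraph G) m e) (long : 4 ℕ.≤ suc m) where
    private
      e-injective : ∀ i j → e i ≡ e j → i ≡ j
      e-injective = proj₁ (proj₂ (proj₁ induced))
      e-adjacent : ∀ i → e i ∼ᴸ e (next i)
      e-adjacent = proj₂ (proj₂ (proj₁ induced))
      chordless : ∀ i j → i ≢ j → j ≢ next i → i ≢ next j → ¬ e i ∼ᴸ e j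
      chordless = proj₂ induced
      2<1+m : 2 ℕ.< suc m
      2<1+m = ≤-trans (n≤1+n 3) long
      1<1+m : 1 ℕ.< suc m
      1<1+m = ≤-trans (n≤1+n 2) 2<1+m

    sharedVertex : Fin (suc m) → Fin n
    sharedVertex i = proj₁ (proj₂ (e-adjacent i))

    sharedVertex-∈ : ∀ i → sharedVertex i ∈ e i
    sharedVertex-∈ i = proj₁ (proj₂ (proj₂ (e-adjacent i)))

    sharedVertex-∈⁺ : ∀ i → sharedVertex i ∈ e (next i)
    sharedVertex-∈⁺ i = proj₂ (proj₂ (proj₂ (e-adjacent i)))

    sharing⇒consecutive : ∀ {w i j} → w ∈ e i → w ∈ e j → i ≢ j → j ≡ next i ⊎ i ≡ next j
    sharing⇒consecutive {w} {i} {j} w∈eᵢ w∈eⱼ i≢j with j ≟ next i | i ≟ next j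
    ... | yes j≡i⁺ | _        = inj₁ j≡i⁺
    ... | no _     | yes i≡j⁺ = inj₂ i≡j⁺
    ... | no j≢i⁺  | no i≢j⁺  = ⊥-elim (chordless i j i≢j j≢i⁺ i≢j⁺ (i≢j ∘ e-injective i j , w , w∈eᵢ , w∈eⱼ))

    not-on-three-consecutive : ∀ {w} i → w ∈ e i → w ∈ e (next (next i)) → ⊥
    not-on-three-consecutive i w∈eᵢ w∈eᵢ⁺⁺
      with sharing⇒consecutive w∈eᵢ w∈eᵢ⁺⁺ (next-iterate-≢ 2 i z<s 2<1+m ∘ sym)
    ... | inj₁ i⁺⁺≡i⁺ = next-iterate-≢ 1 i z<s 1<1+m (next-injective i⁺⁺≡i⁺)
    ... | inj₂ i≡i⁺⁺⁺ = next-iterate-≢ 3 i z<s long (sym i≡i⁺⁺⁺)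

    sharedVertex-injective : ∀ i j → sharedVertex i ≡ sharedVertex j → i ≡ j
    sharedVertex-injective i j eq with i ≟ j
    ... | yes i≡j = i≡j
    ... | no i≢j with sharing⇒consecutive (sharedVertex-∈ i) (subst (_∈ e j) (sym eq) (sharedVertex-∈ j)) i≢j
    ... | inj₁ refl = ⊥-elim (not-on-three-consecutive i (sharedVertex-∈ i) (subst (_∈ e (next j)) (sym eq) (sharedVertex-∈⁺ j)))
    ... | inj₂ refl = ⊥-elim (not-on-three-consecutive j (sharedVertex-∈ j) (subst (_∈ e (next i)) eq (sharedVertex-∈⁺ i)))

    sharedVertices-cycle : IsCycle (toGraph G) m sharedVertex
    sharedVertices-cycle = 2<1+m , sharedVertex-injective , consecutive-adjacent
      where
      consecutive-adjacent : ∀ i → sharedVertex i ∼ sharedVertex (next i)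
      consecutive-adjacent i = endpoints-adjacent (e (next i)) (sharedVertex-∈⁺ i) (sharedVertex-∈ (next i))
        (next-iterate-≢ 1 i z<s 1<1+m ∘ sym ∘ sharedVertex-injective _ _)

  chordal-lineGraph⇒cycles-triangles : Chordal (LineGraph G) → AllCyclesTriangles (toGraph G)
  chordal-lineGraph⇒cycles-triangles chordal m c cycle with m≤n⇒m<n∨m≡n (proj₁ cycle)
  ... | inj₁ 3<1+m = ⊥-elim (chordal m (cycleEdge cycle) 3<1+m (cycleEdges-induced cycle))
  ... | inj₂ 3≡1+m = sym 3≡1+m

  cycles-triangles⇒chordal-lineGraph : AllCyclesTriangles (toGraph G) → Chordal (LineGraph G)
  cycles-triangles⇒chordal-lineGraph triangles m e long induced =
    <⇒≢ long (sym (triangles m (sharedVertex induced long) (sharedVertices-cycle induced long)))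

mainTheorem10 : ∀ (n : ℕ) (G : FinGraph n) → (Chordal (LineGraph G) → AllCyclesTriangles (toGraph G)) × (AllCyclesTriangles (toGraph G) → Chordal (LineGraph G))
mainTheorem10 n G = chordal-lineGraph⇒cycles-triangles G , cycles-triangles⇒chordal-lineGraph G
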